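{- There are infinitely many (pairwise non-isomorphic) finite simple graphs that are both $2$-connected and matching integral.
   Context: All graphs are finite and simple. For a graph $G$ on $n$ vertices and an integer $r\ge 0$, an $r$-matching is a set of $r$ pairwise non-incident edges of $G$, and $m(G,r)$ denotes the number of $r$-matchings of $G$ (with $m(G,0)=1$). The matching polynomial of $G$ is $\mu(G,x)=\sum_{r=0}^{\lfloor n/2\rfloor}(-1)^r m(G,r)x^{n-2r}$. A graph is called matching integral if all zeros of its matching polynomial are integers. -}

module Defs where

open import Data.Bool using (Bool; true; false; _∧_; not)
open import Data.Nat using (ℕ; zero; suc; _∸_; _<ᵇ_; _≡ᵇ_; _/_; _≤_; _*_)
open import Data.Integer as ℤ using (ℤ; +_; -_; _^_)
open import Data.Fin using (Fin; toℕ; _≟_)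
open import Data.Fin.Properties using ()
open import Data.List using (List; []; _∷_; length; filterᵇ; concatMap; map; allFin; upTo; foldr)
open import Data.Vec as Vec using (Vec)
open import Data.Product using (Σ; _×_; _,_; proj₁; proj₂; ∃)
open import Relation.Binary.PropositionalEquality using (_≡_; _≢_)
open import Relation.Nullary using (¬_; ⌊_⌋)
open import Function.Bundles using (_↔_; Inverse)

record Graph (n : ℕ) : Set where
  field
    adj   : Fin n → Fin n → Bool
    sym   : ∀ i j → adj i j ≡ adj j i
    irrefl : ∀ i → adj i i ≡ false
open Graph public

edges : ∀ {n} → Graph n → List (Fin n × Fin n)
edges {n} G =
  filterᵇ (λ e → (toℕ (proj₁ e) <ᵇ toℕ (proj₂ e)) ∧ adj G (proj₁ e) (proj₂ e))
    (concatMap (λ i → map (λ j → (i , j)) (allFin n)) (allFin n))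

-- All sublists (= subsets, for a duplicate-free list) of a list.
sublists : ∀ {A : Set} → List A → List (List A)
sublists [] = [] ∷ []
sublists (x ∷ xs) = let s = sublists xs in s Data.List.++ map (x ∷_) s

nonIncident : ∀ {n} → Fin n × Fin n → Fin n × Fin n → Bool
nonIncident (a , b) (c , d) =
  not ⌊ a ≟ c ⌋ ∧ not ⌊ a ≟ d ⌋ ∧ not ⌊ b ≟ c ⌋ ∧ not ⌊ b ≟ d ⌋

allᵇ : ∀ {A : Set} → (A → Bool) → List A → Bool
allᵇ p [] = true
allᵇ p (x ∷ xs) = p x ∧ allᵇ p xs

isMatching : ∀ {n} → List (Fin n × Fin n) → Bool
isMatching [] = true
isMatching (e ∷ es) = allᵇ (nonIncident e) es ∧ isMatching es

numMatchings : ∀ {n} → Graph n → ℕ → ℕ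
numMatchings G r =
  length (filterᵇ (λ s → (length s ≡ᵇ r) ∧ isMatching s) (sublists (edges G)))

matchingPoly : ∀ {n} → Graph n → ℤ → ℤ
matchingPoly {n} G x =
  foldr ℤ._+_ (+ 0)
    (map (λ r → ((- (+ 1)) ^ r) ℤ.* (+ numMatchings G r) ℤ.* (x ^ (n ∸ 2 * r)))
         (upTo (suc (n / 2))))

-- A graph is matching integral if all zeros of its matching polynomial are
-- integers, i.e. (μ being monic of degree n) μ(G,x) = ∏_{i} (x - a_i) for
-- some integers a_1..a_n (equality of polynomials over ℤ, checked as
-- equality of the polynomial functions on ℤ).
MatchingIntegral : ∀ {n} → Graph n → Set
MatchingIntegral {n} G =
  Σ (Vec ℤ n) λ a → ∀ (x : ℤ) →
    matchingPoly G x ≡ Vec.foldr _ (λ ai acc → (x ℤ.- ai) ℤ.* acc) (+ 1) a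

data ReachAvoiding {n} (G : Graph n) (v : Fin n) : Fin n → Fin n → Set where
  here : ∀ {u} → u ≢ v → ReachAvoiding G v u u
  step : ∀ {u w z} → u ≢ v → adj G u w ≡ true → ReachAvoiding G v w z →
         ReachAvoiding G v u z

data Reach {n} (G : Graph n) : Fin n → Fin n → Set where
  here : ∀ {u} → Reach G u u
  step : ∀ {u w z} → adj G u w ≡ true → Reach G w z → Reach G u z

Connected : ∀ {n} → Graph n → Set
Connected G = ∀ u w → Reach G u w

TwoConnected : ∀ {n} → Graph n → Set
TwoConnected {n} G =
  (3 ≤ n) × Connected G × (∀ v u w → u ≢ v → w ≢ v → ReachAvoiding G v u w)

Isomorphic : ∀ {n m} → Graph n → Graph m → Set
Isomorphic {n} {m} G H =
  Σ (Fin n ↔ Fin m) λ f → ∀ i j → adj G i j ≡ adj H (Inverse.to f i) (Inverse.to f j)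

AnyGraph : Set
AnyGraph = Σ ℕ Graph

-- The graph Gₛ has vertices a, b, c, x₁, x₂, y₁, …, yₛ; b and c are joined to every x and every y,
-- and a is joined to b and to every y.  Its edges form three stars, centred at a, b and c, so no
-- matching has more than three edges, and choosing at most one edge at each centre gives
--   m₁ = 3s + 5,   m₂ = 3s² + 6s + 4,   m₃ = s²(s + 1).
-- Hence μ(Gₛ, x) = x^(s-1) (z³ − (3s+5) z² + (3s²+6s+4) z − s²(s+1)) with z = x², and the cubic is
-- (z − (s+1)) (z² − 2(s+2) z + s²).  When s + 1 = q² its roots are (q−1)², q², (q+1)², so for
-- s = (k+1)(k+3) the graph is matching integral, with zeros 0, ±(k+1), ±(k+2), ±(k+3).
-- For s ≥ 1, Gₛ is 2-connected: after deleting a vertex v ≠ b every other vertex reaches b in at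
-- most two steps (c through an x ≠ v), and after deleting b every other vertex reaches c (a through
-- a y).  Distinct k give distinct orders 5 + s, hence non-isomorphic graphs.

{-# OPTIONS --safe #-}
module Submission where

open import Defs hiding (sym)
open import Data.Bool using (Bool; true; false; _∧_; _∨_; not; T?)
open import Data.Bool.Properties using (∧-assoc; ∧-comm; ∧-zeroʳ; ∧-identityʳ; ∨-comm)
open import Data.Nat using (ℕ; zero; suc; _+_; _*_; _∸_; _≤_; _<_; _≡ᵇ_; _<ᵇ_; s≤s; z≤n)
open import Data.Nat.DivMod using (/-monoˡ-≤)
open import Data.Nat.ListAction using (sum)
open import Data.Nat.Properties
  using (+-identityʳ; +-comm; +-assoc; +-suc; *-zeroʳ; <-cmp; <⇒≢; +-monoʳ-<; *-mono-<; +-cancelˡ-≡)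
open import Data.Nat.Tactic.RingSolver using (solve-∀)
open import Data.List
  using (List; []; _∷_; _++_; length; map; filterᵇ; allFin; tabulate; concat; concatMap; foldr; upTo; applyUpTo)
open import Data.List.Properties
  using (length-++; length-map; filter-++; map-tabulate; length-tabulate; ++-identityʳ; map-∘)
open import Data.Fin using (Fin; _≟_; _↑ʳ_; toℕ) renaming (zero to fzero; suc to fsuc)
open import Data.Fin.Permutation using (↔⇒≡)
open import Data.Product using (Σ; _×_; _,_; proj₂)
open import Function using (_∘_; id)
open import Relation.Binary.Definitions using (tri<; tri≈; tri>)
open import Relation.Binary.PropositionalEquality
open import Relation.Nullary using (¬_; ⌊_⌋; yes; no; contradiction)

module _ {A : Set} where

  filterᵇ-cong : {p q : A → Bool} → (∀ x → p x ≡ q x) → ∀ xs → filterᵇ p xs ≡ filterᵇ q xs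
  filterᵇ-cong {p} {q} p≗q [] = refl
  filterᵇ-cong {p} {q} p≗q (x ∷ xs) with p x | q x | p≗q x
  ... | true  | .true  | refl = cong (x ∷_) (filterᵇ-cong p≗q xs)
  ... | false | .false | refl = filterᵇ-cong p≗q xs

  filterᵇ-all : {p : A → Bool} → (∀ x → p x ≡ true) → ∀ xs → filterᵇ p xs ≡ xs
  filterᵇ-all all [] = refl
  filterᵇ-all all (x ∷ xs) rewrite all x = cong (x ∷_) (filterᵇ-all all xs)

  filterᵇ-none : {p : A → Bool} → (∀ x → p x ≡ false) → ∀ xs → filterᵇ p xs ≡ []
  filterᵇ-none none [] = refl
  filterᵇ-none none (x ∷ xs) rewrite none x = filterᵇ-none none xs

  filterᵇ-filterᵇ : (p q : A → Bool) → ∀ xs → filterᵇ p (filterᵇ q xs) ≡ filterᵇ (λ x → q x ∧ p x) xs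
  filterᵇ-filterᵇ p q [] = refl
  filterᵇ-filterᵇ p q (x ∷ xs) with q x
  ... | false = filterᵇ-filterᵇ p q xs
  ... | true with p x
  ...   | true  = cong (x ∷_) (filterᵇ-filterᵇ p q xs)
  ...   | false = filterᵇ-filterᵇ p q xs

  filterᵇ-map : ∀ {B : Set} (p : B → Bool) (f : A → B) xs →
    filterᵇ p (map f xs) ≡ map f (filterᵇ (p ∘ f) xs)
  filterᵇ-map p f [] = refl
  filterᵇ-map p f (x ∷ xs) with p (f x)
  ... | true  = cong (f x ∷_) (filterᵇ-map p f xs)
  ... | false = filterᵇ-map p f xs

  length-filterᵇ-map : ∀ {B : Set} (p : B → Bool) (f : A → B) xs →
    length (filterᵇ p (map f xs)) ≡ length (filterᵇ (p ∘ f) xs)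
  length-filterᵇ-map p f xs = trans (cong length (filterᵇ-map p f xs)) (length-map f (filterᵇ (p ∘ f) xs))

  sum-map-const : ∀ (f : A → ℕ) {c} → (∀ x → f x ≡ c) → ∀ xs → sum (map f xs) ≡ length xs * c
  sum-map-const f fx≡c [] = refl
  sum-map-const f fx≡c (x ∷ xs) = cong₂ _+_ (fx≡c x) (sum-map-const f fx≡c xs)

  sum-map-filterᵇ-const : ∀ (p : A → Bool) (f : A → ℕ) {c} → (∀ x → p x ≡ true → f x ≡ c) →
    ∀ xs → sum (map f (filterᵇ p xs)) ≡ length (filterᵇ p xs) * c
  sum-map-filterᵇ-const p f fx≡c [] = refl
  sum-map-filterᵇ-const p f fx≡c (x ∷ xs) with p x in px
  ... | true  = cong₂ _+_ (fx≡c x px) (sum-map-filterᵇ-const p f fx≡c xs)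
  ... | false = sum-map-filterᵇ-const p f fx≡c xs

  concatMap-[] : ∀ {B : Set} (f : A → List B) → (∀ x → f x ≡ []) → ∀ xs → concatMap f xs ≡ []
  concatMap-[] f f≡[] [] = refl
  concatMap-[] f f≡[] (x ∷ xs) rewrite f≡[] x = concatMap-[] f f≡[] xs

  filterᵇ-concatMap : ∀ {B : Set} (p : B → Bool) (f : A → List B) xs →
    filterᵇ p (concatMap f xs) ≡ concatMap (filterᵇ p ∘ f) xs
  filterᵇ-concatMap p f [] = refl
  filterᵇ-concatMap p f (x ∷ xs) =
    trans (filter-++ _ (f x) (concatMap f xs)) (cong (filterᵇ p (f x) ++_) (filterᵇ-concatMap p f xs))

  length-filterᵇ-++ : ∀ (p : A → Bool) xs ys →
    length (filterᵇ p (xs ++ ys)) ≡ length (filterᵇ p xs) + length (filterᵇ p ys)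
  length-filterᵇ-++ p xs ys = trans (cong length (filter-++ _ xs ys)) (length-++ (filterᵇ p xs))

sublists-filterᵇ : ∀ {A : Set} (p : A → Bool) xs →
  sublists (filterᵇ p xs) ≡ filterᵇ (allᵇ p) (sublists xs)
sublists-filterᵇ p [] = refl
sublists-filterᵇ p (x ∷ xs) with p x in px
... | true = begin
  ys ++ map (x ∷_) ys
    ≡⟨ cong (λ zs → zs ++ map (x ∷_) zs) (sublists-filterᵇ p xs) ⟩
  filterᵇ (allᵇ p) xss ++ map (x ∷_) (filterᵇ (allᵇ p) xss)
    ≡⟨ cong (λ zs → filterᵇ (allᵇ p) xss ++ map (x ∷_) zs)
         (filterᵇ-cong (λ S → cong (_∧ allᵇ p S) (sym px)) xss) ⟩
  filterᵇ (allᵇ p) xss ++ map (x ∷_) (filterᵇ (allᵇ p ∘ (x ∷_)) xss)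
    ≡⟨ cong (filterᵇ (allᵇ p) xss ++_) (sym (filterᵇ-map (allᵇ p) (x ∷_) xss)) ⟩
  filterᵇ (allᵇ p) xss ++ filterᵇ (allᵇ p) (map (x ∷_) xss)
    ≡⟨ sym (filter-++ _ xss _) ⟩
  filterᵇ (allᵇ p) (xss ++ map (x ∷_) xss) ∎
  where
  open ≡-Reasoning
  ys = sublists (filterᵇ p xs)
  xss = sublists xs
... | false = begin
  sublists (filterᵇ p xs)
    ≡⟨ sublists-filterᵇ p xs ⟩
  filterᵇ (allᵇ p) xss
    ≡⟨ sym (++-identityʳ _) ⟩
  filterᵇ (allᵇ p) xss ++ []
    ≡⟨ cong (filterᵇ (allᵇ p) xss ++_) (sym (trans (filterᵇ-map (allᵇ p) (x ∷_) xss)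
         (cong (map (x ∷_)) (filterᵇ-none (λ S → cong (_∧ allᵇ p S) px) xss)))) ⟩
  filterᵇ (allᵇ p) xss ++ filterᵇ (allᵇ p) (map (x ∷_) xss)
    ≡⟨ sym (filter-++ _ xss _) ⟩
  filterᵇ (allᵇ p) (xss ++ map (x ∷_) xss) ∎
  where
  open ≡-Reasoning
  xss = sublists xs

Edge : ℕ → Set
Edge n = Fin n × Fin n

countMatchings : ∀ {n} → List (Edge n) → ℕ → ℕ
countMatchings L r = length (filterᵇ (λ S → (length S ≡ᵇ r) ∧ isMatching S) (sublists L))

module _ {n} (e : Edge n) (es : List (Edge n)) where

  countMatchings-∷ : ∀ r → countMatchings (e ∷ es) r ≡
    countMatchings es r
    + length (filterᵇ (λ S → (suc (length S) ≡ᵇ r) ∧ (allᵇ (nonIncident e) S ∧ isMatching S)) (sublists es))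
  countMatchings-∷ r = trans (cong length (filter-++ _ (sublists es) _))
    (trans (length-++ (filterᵇ _ (sublists es)))
      (cong (countMatchings es r +_) (length-filterᵇ-map _ (e ∷_) (sublists es))))

  countMatchings-∷-suc : ∀ r → countMatchings (e ∷ es) (suc r) ≡
    countMatchings es (suc r) + countMatchings (filterᵇ (nonIncident e) es) r
  countMatchings-∷-suc r = trans (countMatchings-∷ (suc r)) (cong (countMatchings es (suc r) +_) (sym (begin
    length (filterᵇ Q (sublists (filterᵇ (nonIncident e) es)))
      ≡⟨ cong (length ∘ filterᵇ Q) (sublists-filterᵇ (nonIncident e) es) ⟩
    length (filterᵇ Q (filterᵇ (allᵇ (nonIncident e)) (sublists es)))
      ≡⟨ cong length (filterᵇ-filterᵇ Q _ (sublists es)) ⟩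
    length (filterᵇ (λ S → allᵇ (nonIncident e) S ∧ Q S) (sublists es))
      ≡⟨ cong length (filterᵇ-cong (λ S → ∧-swap (allᵇ (nonIncident e) S) (length S ≡ᵇ r) _) (sublists es)) ⟩
    length (filterᵇ (λ S → (length S ≡ᵇ r) ∧ (allᵇ (nonIncident e) S ∧ isMatching S)) (sublists es)) ∎)))
    where
    open ≡-Reasoning
    Q : List (Edge n) → Bool
    Q S = (length S ≡ᵇ r) ∧ isMatching S
    ∧-swap : ∀ a b c → a ∧ (b ∧ c) ≡ b ∧ (a ∧ c)
    ∧-swap a b c = trans (sym (∧-assoc a b c)) (trans (cong (_∧ c) (∧-comm a b)) (∧-assoc b a c))

countMatchings-zero : ∀ {n} (L : List (Edge n)) → countMatchings L 0 ≡ 1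
countMatchings-zero [] = refl
countMatchings-zero (e ∷ es) = trans (countMatchings-∷ e es 0)
  (trans (cong (countMatchings es 0 +_) (cong length (filterᵇ-none (λ _ → refl) (sublists es))))
    (trans (+-identityʳ _) (countMatchings-zero es)))

countMatchings-one : ∀ {n} (L : List (Edge n)) → countMatchings L 1 ≡ length L
countMatchings-one [] = refl
countMatchings-one (e ∷ es) = trans (countMatchings-∷-suc e es 0)
  (trans (cong₂ _+_ (countMatchings-one es) (countMatchings-zero (filterᵇ (nonIncident e) es))) (+-comm (length es) 1))

star : ∀ {n} → Fin n → List (Fin n) → List (Edge n)
star h = map (h ,_)

nonIncident-sameCentre : ∀ {n} (h j j′ : Fin n) → nonIncident (h , j) (h , j′) ≡ false
nonIncident-sameCentre h j j′ with h ≟ h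
... | yes _  = refl
... | no h≢h = contradiction refl h≢h

countMatchings-star-++ : ∀ {n} (h : Fin n) J R r → countMatchings (star h J ++ R) (suc r) ≡
  countMatchings R (suc r) + sum (map (λ j → countMatchings (filterᵇ (nonIncident (h , j)) R) r) J)
countMatchings-star-++ h [] R r = sym (+-identityʳ _)
countMatchings-star-++ h (j ∷ J) R r = begin
  countMatchings ((h , j) ∷ star h J ++ R) (suc r)
    ≡⟨ countMatchings-∷-suc (h , j) (star h J ++ R) r ⟩
  countMatchings (star h J ++ R) (suc r) + countMatchings (filterᵇ (nonIncident (h , j)) (star h J ++ R)) r
    ≡⟨ cong₂ _+_ (countMatchings-star-++ h J R r) (cong (λ L → countMatchings L r) star-dropped) ⟩
  (countMatchings R (suc r) + rest) + mⱼ
    ≡⟨ +-assoc (countMatchings R (suc r)) rest mⱼ ⟩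
  countMatchings R (suc r) + (rest + mⱼ)
    ≡⟨ cong (countMatchings R (suc r) +_) (+-comm rest mⱼ) ⟩
  countMatchings R (suc r) + (mⱼ + rest) ∎
  where
  open ≡-Reasoning
  mⱼ = countMatchings (filterᵇ (nonIncident (h , j)) R) r
  rest = sum (map (λ j → countMatchings (filterᵇ (nonIncident (h , j)) R) r) J)
  star-dropped : filterᵇ (nonIncident (h , j)) (star h J ++ R) ≡ filterᵇ (nonIncident (h , j)) R
  star-dropped = trans (filter-++ _ (star h J) R)
    (cong (_++ filterᵇ (nonIncident (h , j)) R)
      (trans (filterᵇ-map _ (h ,_) J) (cong (map (h ,_)) (filterᵇ-none (nonIncident-sameCentre h j) J))))

data UnionOfStars {n} : ℕ → List (Edge n) → Set where
  noStars : UnionOfStars 0 []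
  addStar : ∀ {k R} h J → UnionOfStars k R → UnionOfStars (suc k) (star h J ++ R)

singleStar : ∀ {n} (h : Fin n) J → UnionOfStars 1 (star h J)
singleStar h J = subst (UnionOfStars 1) (++-identityʳ (star h J)) (addStar h J noStars)

unionOfStars-filterᵇ : ∀ {n k} {L : List (Edge n)} (p : Edge n → Bool) →
  UnionOfStars k L → UnionOfStars k (filterᵇ p L)
unionOfStars-filterᵇ p noStars = noStars
unionOfStars-filterᵇ p (addStar {R = R} h J U) =
  subst (UnionOfStars _) (sym (trans (filter-++ _ (star h J) R) (cong (_++ filterᵇ p R) (filterᵇ-map p (h ,_) J))))
    (addStar h (filterᵇ (p ∘ (h ,_)) J) (unionOfStars-filterᵇ p U))

countMatchings-unionOfStars : ∀ {n k} {L : List (Edge n)} → UnionOfStars k L → ∀ r → countMatchings L (suc k + r) ≡ 0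
countMatchings-unionOfStars noStars r = refl
countMatchings-unionOfStars {k = suc k} (addStar {R = R} h J U) r = begin
  countMatchings (star h J ++ R) (suc (suc k + r))
    ≡⟨ countMatchings-star-++ h J R (suc k + r) ⟩
  countMatchings R (suc (suc k + r)) + sum (map (λ j → countMatchings (filterᵇ (nonIncident (h , j)) R) (suc k + r)) J)
    ≡⟨ cong₂ _+_ (trans (cong (countMatchings R) (sym (+-suc (suc k) r))) (countMatchings-unionOfStars U (suc r)))
         (sum-map-const _ (λ j → countMatchings-unionOfStars (unionOfStars-filterᵇ _ U) r) J) ⟩
  length J * 0
    ≡⟨ *-zeroʳ (length J) ⟩
  0 ∎
  where open ≡-Reasoning

_≢ᵇ_ : ∀ {n} → Fin n → Fin n → Bool
y ≢ᵇ z = not ⌊ y ≟ z ⌋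

-- Not definitional: ⌊_⌋ does not compute through the map′ in the suc case of Data.Fin._≟_.
fsuc-≢ᵇ-fsuc : ∀ {n} (y z : Fin n) → fsuc y ≢ᵇ fsuc z ≡ y ≢ᵇ z
fsuc-≢ᵇ-fsuc y z with y ≟ z
... | yes _ = refl
... | no _  = refl

length-filterᵇ-tabulate-suc : ∀ {t} (p : Fin (suc t) → Bool) →
  length (filterᵇ p (tabulate fsuc)) ≡ length (filterᵇ (λ z → p (fsuc z)) (allFin t))
length-filterᵇ-tabulate-suc {t} p =
  trans (cong (length ∘ filterᵇ p) (sym (map-tabulate id fsuc))) (length-filterᵇ-map p fsuc (allFin t))

length-filterᵇ-≢ᵇ : ∀ {s} (y : Fin s) → suc (length (filterᵇ (y ≢ᵇ_) (allFin s))) ≡ s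
length-filterᵇ-≢ᵇ {suc t} fzero = cong suc (begin
  length (filterᵇ (fzero ≢ᵇ_) (tabulate {n = t} fsuc))
    ≡⟨ length-filterᵇ-tabulate-suc {t} (fzero ≢ᵇ_) ⟩
  length (filterᵇ (λ _ → true) (allFin t))
    ≡⟨ cong length (filterᵇ-all (λ _ → refl) (allFin t)) ⟩
  length (allFin t)
    ≡⟨ length-tabulate id ⟩
  t ∎)
  where open ≡-Reasoning
length-filterᵇ-≢ᵇ {suc t} (fsuc y) = cong suc (begin
  suc (length (filterᵇ (fsuc y ≢ᵇ_) (tabulate {n = t} fsuc)))
    ≡⟨ cong suc (length-filterᵇ-tabulate-suc {t} (fsuc y ≢ᵇ_)) ⟩
  suc (length (filterᵇ (λ z → fsuc y ≢ᵇ fsuc z) (allFin t)))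
    ≡⟨ cong (suc ∘ length) (filterᵇ-cong (fsuc-≢ᵇ-fsuc y) (allFin t)) ⟩
  suc (length (filterᵇ (y ≢ᵇ_) (allFin t)))
    ≡⟨ length-filterᵇ-≢ᵇ y ⟩
  t ∎)
  where open ≡-Reasoning

length-filterᵇ-≢ᵇ₂ : ∀ {s} {y y′ : Fin s} → y ≢ y′ →
  2 + length (filterᵇ (λ z → y ≢ᵇ z ∧ y′ ≢ᵇ z) (allFin s)) ≡ s
length-filterᵇ-≢ᵇ₂ {y = fzero} {fzero} y≢y′ = contradiction refl y≢y′
length-filterᵇ-≢ᵇ₂ {suc t} {fzero} {fsuc y′} _ = cong suc (begin
  suc (length (filterᵇ (λ z → fzero ≢ᵇ z ∧ fsuc y′ ≢ᵇ z) (tabulate {n = t} fsuc)))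
    ≡⟨ cong suc (length-filterᵇ-tabulate-suc {t} (λ z → fzero ≢ᵇ z ∧ fsuc y′ ≢ᵇ z)) ⟩
  suc (length (filterᵇ (λ z → fsuc y′ ≢ᵇ fsuc z) (allFin t)))
    ≡⟨ cong (suc ∘ length) (filterᵇ-cong (fsuc-≢ᵇ-fsuc y′) (allFin t)) ⟩
  suc (length (filterᵇ (y′ ≢ᵇ_) (allFin t)))
    ≡⟨ length-filterᵇ-≢ᵇ y′ ⟩
  t ∎)
  where open ≡-Reasoning
length-filterᵇ-≢ᵇ₂ {suc t} {fsuc y} {fzero} _ = cong suc (begin
  suc (length (filterᵇ (λ z → fsuc y ≢ᵇ z ∧ fzero ≢ᵇ z) (tabulate {n = t} fsuc)))
    ≡⟨ cong suc (length-filterᵇ-tabulate-suc {t} (λ z → fsuc y ≢ᵇ z ∧ fzero ≢ᵇ z)) ⟩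
  suc (length (filterᵇ (λ z → fsuc y ≢ᵇ fsuc z ∧ true) (allFin t)))
    ≡⟨ cong (suc ∘ length) (filterᵇ-cong (λ z → trans (∧-identityʳ _) (fsuc-≢ᵇ-fsuc y z)) (allFin t)) ⟩
  suc (length (filterᵇ (y ≢ᵇ_) (allFin t)))
    ≡⟨ length-filterᵇ-≢ᵇ y ⟩
  t ∎)
  where open ≡-Reasoning
length-filterᵇ-≢ᵇ₂ {suc t} {fsuc y} {fsuc y′} y≢y′ = cong suc (begin
  2 + length (filterᵇ (λ z → fsuc y ≢ᵇ z ∧ fsuc y′ ≢ᵇ z) (tabulate {n = t} fsuc))
    ≡⟨ cong (2 +_) (length-filterᵇ-tabulate-suc {t} (λ z → fsuc y ≢ᵇ z ∧ fsuc y′ ≢ᵇ z)) ⟩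
  2 + length (filterᵇ (λ z → fsuc y ≢ᵇ fsuc z ∧ fsuc y′ ≢ᵇ fsuc z) (allFin t))
    ≡⟨ cong ((2 +_) ∘ length) (filterᵇ-cong (λ z → cong₂ _∧_ (fsuc-≢ᵇ-fsuc y z) (fsuc-≢ᵇ-fsuc y′ z)) (allFin t)) ⟩
  2 + length (filterᵇ (λ z → y ≢ᵇ z ∧ y′ ≢ᵇ z) (allFin t))
    ≡⟨ length-filterᵇ-≢ᵇ₂ (y≢y′ ∘ cong fsuc) ⟩
  t ∎)
  where open ≡-Reasoning

↑ʳ-≢ᵇ-↑ʳ : ∀ {n} k (i j : Fin n) → (k ↑ʳ i) ≢ᵇ (k ↑ʳ j) ≡ i ≢ᵇ j
↑ʳ-≢ᵇ-↑ʳ zero    i j = refl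
↑ʳ-≢ᵇ-↑ʳ (suc k) i j = trans (fsuc-≢ᵇ-fsuc (k ↑ʳ i) (k ↑ʳ j)) (↑ʳ-≢ᵇ-↑ʳ k i j)

≢ᵇ⇒≢ : ∀ {n} {i j : Fin n} → i ≢ᵇ j ≡ true → i ≢ j
≢ᵇ⇒≢ {i = i} {j} i≢ᵇj i≡j with i ≟ j
... | yes _   = contradiction i≢ᵇj λ ()
... | no i≢j = i≢j i≡j

module _ {n} (G : Graph n) where

  reach-trans : ∀ {u v w} → Reach G u v → Reach G v w → Reach G u w
  reach-trans here        q = q
  reach-trans (step uv p) q = step uv (reach-trans p q)

  reach-sym : ∀ {u w} → Reach G u w → Reach G w u
  reach-sym here        = here
  reach-sym (step uv p) = reach-trans (reach-sym p) (step (trans (Graph.sym G _ _) uv) here)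

  connected-via-root : ∀ {r} → (∀ u → Reach G u r) → Connected G
  connected-via-root to-r u w = reach-trans (to-r u) (reach-sym (to-r w))

  reachAvoiding⇒reach : ∀ {v u w} → ReachAvoiding G v u w → Reach G u w
  reachAvoiding⇒reach (here _)      = here
  reachAvoiding⇒reach (step _ uv p) = step uv (reachAvoiding⇒reach p)

  reachAvoiding-source : ∀ {v u w} → ReachAvoiding G v u w → u ≢ v
  reachAvoiding-source (here u≢v)     = u≢v
  reachAvoiding-source (step u≢v _ _) = u≢v

  reachAvoiding-trans : ∀ {v u w z} → ReachAvoiding G v u w → ReachAvoiding G v w z → ReachAvoiding G v u z
  reachAvoiding-trans (here _)        q = q
  reachAvoiding-trans (step u≢v uw p) q = step u≢v uw (reachAvoiding-trans p q)

  reachAvoiding-sym : ∀ {v u w} → ReachAvoiding G v u w → ReachAvoiding G v w u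
  reachAvoiding-sym (here u≢v)      = here u≢v
  reachAvoiding-sym (step u≢v uw p) =
    reachAvoiding-trans (reachAvoiding-sym p) (step (reachAvoiding-source p) (trans (Graph.sym G _ _) uw) (here u≢v))

  avoiding-connected-via-hubs : (hub : Fin n → Fin n) → (∀ v u → u ≢ v → ReachAvoiding G v u (hub v)) →
    ∀ v u w → u ≢ v → w ≢ v → ReachAvoiding G v u w
  avoiding-connected-via-hubs hub to-hub v u w u≢v w≢v =
    reachAvoiding-trans (to-hub v u u≢v) (reachAvoiding-sym (to-hub v w w≢v))

data Kind : Set where
  kA kB kC kX kY : Kind

kindEdge : Kind → Kind → Bool
kindEdge kA kB = true
kindEdge kA kY = true
kindEdge kB kX = true
kindEdge kB kY = true
kindEdge kC kX = true
kindEdge kC kY = true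
kindEdge _  _  = false

kindAdj : Kind → Kind → Bool
kindAdj k l = kindEdge k l ∨ kindEdge l k

kindAdj-irrefl : ∀ k → kindAdj k k ≡ false
kindAdj-irrefl kA = refl
kindAdj-irrefl kB = refl
kindAdj-irrefl kC = refl
kindAdj-irrefl kX = refl
kindAdj-irrefl kY = refl

module Family (s : ℕ) where

  kind : Fin (5 + s) → Kind
  kind fzero                                   = kA
  kind (fsuc fzero)                            = kB
  kind (fsuc (fsuc fzero))                     = kC
  kind (fsuc (fsuc (fsuc fzero)))              = kX
  kind (fsuc (fsuc (fsuc (fsuc fzero))))       = kX
  kind (fsuc (fsuc (fsuc (fsuc (fsuc _)))))    = kY

  a b c x₁ x₂ : Fin (5 + s)
  a  = fzero
  b  = fsuc fzero
  c  = fsuc (fsuc fzero)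
  x₁ = fsuc (fsuc (fsuc fzero))
  x₂ = fsuc (fsuc (fsuc (fsuc fzero)))

  y : Fin s → Fin (5 + s)
  y = 5 ↑ʳ_

  ys xys : List (Fin (5 + s))
  ys  = map y (allFin s)
  xys = x₁ ∷ x₂ ∷ ys

  allFin-vertices : allFin (5 + s) ≡ a ∷ b ∷ c ∷ x₁ ∷ x₂ ∷ ys
  allFin-vertices = cong (λ vs → a ∷ b ∷ c ∷ x₁ ∷ x₂ ∷ vs) (sym (map-tabulate id y))

  filterᵇ-ys-all : {p : Fin (5 + s) → Bool} → (∀ j → p (y j) ≡ true) → filterᵇ p ys ≡ ys
  filterᵇ-ys-all {p} all = trans (filterᵇ-map p y (allFin s)) (cong (map y) (filterᵇ-all all (allFin s)))

  filterᵇ-ys-none : {p : Fin (5 + s) → Bool} → (∀ j → p (y j) ≡ false) → filterᵇ p ys ≡ []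
  filterᵇ-ys-none {p} none = trans (filterᵇ-map p y (allFin s)) (cong (map y) (filterᵇ-none none (allFin s)))

  length-ys : length ys ≡ s
  length-ys = trans (length-map y (allFin s)) (length-tabulate id)

  length-filterᵇ-ys-all : {p : Fin (5 + s) → Bool} → (∀ j → p (y j) ≡ true) → length (filterᵇ p ys) ≡ s
  length-filterᵇ-ys-all all = trans (cong length (filterᵇ-ys-all all)) length-ys

  length-filterᵇ-ys : {p : Fin (5 + s) → Bool} {q : Fin s → Bool} → (∀ j → p (y j) ≡ q j) →
    length (filterᵇ p ys) ≡ length (filterᵇ q (allFin s))
  length-filterᵇ-ys {p} p∘y≗q = trans (length-filterᵇ-map p y (allFin s)) (cong length (filterᵇ-cong p∘y≗q (allFin s)))

  length-filterᵇ-ys-≢ᵇ : {p : Fin (5 + s) → Bool} (j : Fin s) → (∀ k → p (y k) ≡ j ≢ᵇ k) →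
    suc (length (filterᵇ p ys)) ≡ s
  length-filterᵇ-ys-≢ᵇ j p∘y≗ = trans (cong suc (length-filterᵇ-ys p∘y≗)) (length-filterᵇ-≢ᵇ j)

  length-filterᵇ-ys-≢ᵇ₂ : {p : Fin (5 + s) → Bool} {j k : Fin s} → j ≢ k → (∀ l → p (y l) ≡ (j ≢ᵇ l ∧ k ≢ᵇ l)) →
    2 + length (filterᵇ p ys) ≡ s
  length-filterᵇ-ys-≢ᵇ₂ j≢k p∘y≗ = trans (cong (2 +_) (length-filterᵇ-ys p∘y≗)) (length-filterᵇ-≢ᵇ₂ j≢k)

  sum-map-ys : (f : Fin (5 + s) → ℕ) {c : ℕ} → (∀ j → f (y j) ≡ c) → sum (map f ys) ≡ s * c
  sum-map-ys f {c} fy≡c = trans (cong sum (sym (map-∘ (allFin s))))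
    (trans (sum-map-const (f ∘ y) fy≡c (allFin s)) (cong (_* c) (length-tabulate {n = s} id)))

  sum-map-ys-≢ᵇ : (f : Fin (5 + s) → ℕ) {p : Fin (5 + s) → Bool} {c : ℕ} (j : Fin s) →
    (∀ k → p (y k) ≡ j ≢ᵇ k) → (∀ k → j ≢ k → f (y k) ≡ c) →
    sum (map f (filterᵇ p ys)) ≡ length (filterᵇ (j ≢ᵇ_) (allFin s)) * c
  sum-map-ys-≢ᵇ f {p} j p∘y≗ fy≡c = begin
    sum (map f (filterᵇ p (map y (allFin s))))
      ≡⟨ cong (sum ∘ map f) (trans (filterᵇ-map p y (allFin s)) (cong (map y) (filterᵇ-cong p∘y≗ (allFin s)))) ⟩
    sum (map f (map y (filterᵇ (j ≢ᵇ_) (allFin s))))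
      ≡⟨ cong sum (sym (map-∘ (filterᵇ (j ≢ᵇ_) (allFin s)))) ⟩
    sum (map (f ∘ y) (filterᵇ (j ≢ᵇ_) (allFin s)))
      ≡⟨ sum-map-filterᵇ-const (j ≢ᵇ_) (f ∘ y) (λ k j≢ᵇk → fy≡c k (≢ᵇ⇒≢ j≢ᵇk)) (allFin s) ⟩
    length (filterᵇ (j ≢ᵇ_) (allFin s)) * _ ∎
    where open ≡-Reasoning

  y-≢ᵇ-y : ∀ j k → y j ≢ᵇ y k ≡ j ≢ᵇ k
  y-≢ᵇ-y = ↑ʳ-≢ᵇ-↑ʳ 5

  graph : Graph (5 + s)
  graph = record
    { adj    = λ u v → kindAdj (kind u) (kind v)
    ; sym    = λ u v → ∨-comm (kindEdge (kind u) (kind v)) (kindEdge (kind v) (kind u))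
    ; irrefl = λ u → kindAdj-irrefl (kind u)
    }

  bcEdges : List (Edge (5 + s))
  bcEdges = star b xys ++ star c xys

  bcEdges-stars : UnionOfStars 2 bcEdges
  bcEdges-stars = addStar b xys (singleStar c xys)

  edgeList : List (Edge (5 + s))
  edgeList = star a (b ∷ ys) ++ bcEdges

  edges-graph : edges graph ≡ edgeList
  edges-graph = begin
    filterᵇ P (concatMap (λ u → star u V) V)
      ≡⟨ filterᵇ-concatMap P (λ u → star u V) V ⟩
    concatMap row V
      ≡⟨ cong (concatMap row) allFin-vertices ⟩
    row a ++ row b ++ row c ++ row x₁ ++ row x₂ ++ concatMap row ys
      ≡⟨ cong₂ _++_ row-a (cong₂ _++_ row-b (cong₂ _++_ row-c (cong₂ _++_ row-x₁ (cong₂ _++_ row-x₂ rows-ys)))) ⟩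
    star a (b ∷ ys) ++ star b xys ++ star c xys ++ []
      ≡⟨ cong (λ L → star a (b ∷ ys) ++ star b xys ++ L) (++-identityʳ (star c xys)) ⟩
    star a (b ∷ ys) ++ star b xys ++ star c xys ∎
    where
    open ≡-Reasoning
    V = allFin (5 + s)
    P : Edge (5 + s) → Bool
    P (u , v) = (toℕ u <ᵇ toℕ v) ∧ kindAdj (kind u) (kind v)
    row : Fin (5 + s) → List (Edge (5 + s))
    row u = filterᵇ P (star u V)
    row≡ : ∀ u → row u ≡ star u (filterᵇ (λ v → P (u , v)) (a ∷ b ∷ c ∷ x₁ ∷ x₂ ∷ ys))
    row≡ u = trans (filterᵇ-map P (u ,_) V) (cong (star u ∘ filterᵇ (λ v → P (u , v))) allFin-vertices)
    row-a : row a ≡ star a (b ∷ ys)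
    row-a = trans (row≡ a) (cong (star a ∘ (b ∷_)) (filterᵇ-ys-all (λ _ → refl)))
    row-b : row b ≡ star b xys
    row-b = trans (row≡ b) (cong (star b ∘ (λ vs → x₁ ∷ x₂ ∷ vs)) (filterᵇ-ys-all (λ _ → refl)))
    row-c : row c ≡ star c xys
    row-c = trans (row≡ c) (cong (star c ∘ (λ vs → x₁ ∷ x₂ ∷ vs)) (filterᵇ-ys-all (λ _ → refl)))
    row-x₁ : row x₁ ≡ []
    row-x₁ = trans (row≡ x₁) (cong (star x₁) (filterᵇ-ys-none (λ _ → refl)))
    row-x₂ : row x₂ ≡ []
    row-x₂ = trans (row≡ x₂) (cong (star x₂) (filterᵇ-ys-none (λ _ → refl)))
    rows-ys : concatMap row ys ≡ []
    rows-ys = trans (cong concat (sym (map-∘ (allFin s))))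
      (concatMap-[] (row ∘ y)
        (λ j → trans (row≡ (y j)) (cong (star (y j)) (filterᵇ-ys-none (λ _ → ∧-zeroʳ _)))) (allFin s))

  numMatchings-graph-edgeList : ∀ r → numMatchings graph r ≡ countMatchings edgeList r
  numMatchings-graph-edgeList r = cong (λ L → countMatchings L r) edges-graph

  numMatchings-graph-1 : numMatchings graph 1 ≡ 3 * s + 5
  numMatchings-graph-1 = begin
    numMatchings graph 1
      ≡⟨ numMatchings-graph-edgeList 1 ⟩
    countMatchings edgeList 1
      ≡⟨ countMatchings-one edgeList ⟩
    length (star a (b ∷ ys) ++ star b xys ++ star c xys)
      ≡⟨ trans (length-++ (star a (b ∷ ys))) (cong (length (star a (b ∷ ys)) +_) (length-++ (star b xys))) ⟩
    length (star a (b ∷ ys)) + (length (star b xys) + length (star c xys))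
      ≡⟨ cong₂ _+_ (length-map _ (b ∷ ys)) (cong₂ _+_ (length-map _ xys) (length-map _ xys)) ⟩
    suc (length ys) + (2 + length ys + (2 + length ys))
      ≡⟨ cong (λ n → suc n + (2 + n + (2 + n))) length-ys ⟩
    suc s + (2 + s + (2 + s))
      ≡⟨ arith s ⟩
    3 * s + 5 ∎
    where
    open ≡-Reasoning
    arith : ∀ s → suc s + (2 + s + (2 + s)) ≡ 3 * s + 5
    arith = solve-∀

  countMatchings-bcEdges-2 : countMatchings bcEdges 2 ≡ suc s + (suc s + s * suc s)
  countMatchings-bcEdges-2 = begin
    countMatchings bcEdges 2
      ≡⟨ countMatchings-star-++ b xys (star c xys) 1 ⟩
    countMatchings (star c xys) 2 + (avoiding-b x₁ + (avoiding-b x₂ + sum (map avoiding-b ys)))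
      ≡⟨ cong₂ _+_ (countMatchings-unionOfStars (singleStar c xys) 0)
           (cong₂ _+_ avoiding-b-x₁ (cong₂ _+_ avoiding-b-x₂ (sum-map-ys avoiding-b avoiding-b-y))) ⟩
    suc s + (suc s + s * suc s) ∎
    where
    open ≡-Reasoning
    avoiding-b : Fin (5 + s) → ℕ
    avoiding-b w = countMatchings (filterᵇ (nonIncident (b , w)) (star c xys)) 1
    avoiding-b≡ : ∀ w → avoiding-b w ≡ length (filterᵇ (λ v → nonIncident (b , w) (c , v)) xys)
    avoiding-b≡ w = trans (countMatchings-one (filterᵇ (nonIncident (b , w)) (star c xys)))
      (length-filterᵇ-map (nonIncident (b , w)) (c ,_) xys)
    avoiding-b-x₁ : avoiding-b x₁ ≡ suc s
    avoiding-b-x₁ = trans (avoiding-b≡ x₁) (cong suc (length-filterᵇ-ys-all (λ _ → refl)))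
    avoiding-b-x₂ : avoiding-b x₂ ≡ suc s
    avoiding-b-x₂ = trans (avoiding-b≡ x₂) (cong suc (length-filterᵇ-ys-all (λ _ → refl)))
    avoiding-b-y : ∀ j → avoiding-b (y j) ≡ suc s
    avoiding-b-y j = trans (avoiding-b≡ (y j)) (cong suc (length-filterᵇ-ys-≢ᵇ j (y-≢ᵇ-y j)))

  numMatchings-graph-2 : numMatchings graph 2 ≡ 3 * s * s + 6 * s + 4
  numMatchings-graph-2 = begin
    numMatchings graph 2
      ≡⟨ numMatchings-graph-edgeList 2 ⟩
    countMatchings (star a (b ∷ ys) ++ bcEdges) 2
      ≡⟨ countMatchings-star-++ a (b ∷ ys) bcEdges 1 ⟩
    countMatchings bcEdges 2 + (avoiding-a b + sum (map avoiding-a ys))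
      ≡⟨ cong₂ _+_ countMatchings-bcEdges-2 (cong₂ _+_ avoiding-a-b (sum-map-ys avoiding-a avoiding-a-y)) ⟩
    suc s + (suc s + s * suc s) + (2 + s + s * (suc s + suc s))
      ≡⟨ arith s ⟩
    3 * s * s + 6 * s + 4 ∎
    where
    open ≡-Reasoning
    avoiding-a : Fin (5 + s) → ℕ
    avoiding-a v = countMatchings (filterᵇ (nonIncident (a , v)) bcEdges) 1
    avoiding-a≡ : ∀ v → avoiding-a v ≡
      length (filterᵇ (λ w → nonIncident (a , v) (b , w)) xys) + length (filterᵇ (λ w → nonIncident (a , v) (c , w)) xys)
    avoiding-a≡ v = begin
      avoiding-a v
        ≡⟨ countMatchings-one (filterᵇ (nonIncident (a , v)) bcEdges) ⟩
      length (filterᵇ (nonIncident (a , v)) bcEdges)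
        ≡⟨ length-filterᵇ-++ (nonIncident (a , v)) (star b xys) (star c xys) ⟩
      length (filterᵇ (nonIncident (a , v)) (star b xys)) + length (filterᵇ (nonIncident (a , v)) (star c xys))
        ≡⟨ cong₂ _+_ (length-filterᵇ-map (nonIncident (a , v)) (b ,_) xys)
                     (length-filterᵇ-map (nonIncident (a , v)) (c ,_) xys) ⟩
      length (filterᵇ (λ w → nonIncident (a , v) (b , w)) xys) + length (filterᵇ (λ w → nonIncident (a , v) (c , w)) xys) ∎
    avoiding-a-b : avoiding-a b ≡ 2 + s
    avoiding-a-b = trans (avoiding-a≡ b)
      (cong₂ _+_ (cong length (filterᵇ-ys-none (λ _ → refl))) (cong (2 +_) (length-filterᵇ-ys-all (λ _ → refl))))
    avoiding-a-y : ∀ j → avoiding-a (y j) ≡ suc s + suc s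
    avoiding-a-y j = trans (avoiding-a≡ (y j))
      (cong₂ _+_ (cong suc (length-filterᵇ-ys-≢ᵇ j (y-≢ᵇ-y j))) (cong suc (length-filterᵇ-ys-≢ᵇ j (y-≢ᵇ-y j))))
    arith : ∀ s → suc s + (suc s + s * suc s) + (2 + s + s * (suc s + suc s)) ≡ 3 * s * s + 6 * s + 4
    arith = solve-∀

  filterᵇ-bcEdges : ∀ (p : Edge (5 + s) → Bool) →
    filterᵇ p bcEdges ≡ star b (filterᵇ (λ w → p (b , w)) xys) ++ star c (filterᵇ (λ w → p (c , w)) xys)
  filterᵇ-bcEdges p = trans (filter-++ (T? ∘ p) (star b xys) (star c xys))
    (cong₂ _++_ (filterᵇ-map p (b ,_) xys) (filterᵇ-map p (c ,_) xys))

  countMatchings-avoiding-ab-2 : countMatchings (filterᵇ (nonIncident (a , b)) bcEdges) 2 ≡ 0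
  countMatchings-avoiding-ab-2 = begin
    countMatchings (filterᵇ (nonIncident (a , b)) bcEdges) 2
      ≡⟨ cong (λ L → countMatchings L 2) (trans (filterᵇ-bcEdges (nonIncident (a , b)))
           (cong (λ J → star b J ++ star c W) (filterᵇ-ys-none (λ _ → refl)))) ⟩
    countMatchings (star c W) 2
      ≡⟨ countMatchings-unionOfStars (singleStar c W) 0 ⟩
    0 ∎
    where
    open ≡-Reasoning
    W = filterᵇ (λ w → nonIncident (a , b) (c , w)) xys

  countMatchings-avoiding-ay-2 : ∀ j → countMatchings (filterᵇ (nonIncident (a , y j)) bcEdges) 2 ≡ s * suc s
  countMatchings-avoiding-ay-2 j = begin
    countMatchings (filterᵇ (nonIncident (a , y j)) bcEdges) 2
      ≡⟨ cong (λ L → countMatchings L 2) (filterᵇ-bcEdges (nonIncident (a , y j))) ⟩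
    countMatchings (star b W ++ star c W) 2
      ≡⟨ countMatchings-star-++ b W (star c W) 1 ⟩
    countMatchings (star c W) 2 + (h x₁ + (h x₂ + sum (map h (filterᵇ q ys))))
      ≡⟨ cong₂ _+_ (countMatchings-unionOfStars (singleStar c W) 0)
           (cong₂ _+_ h-x₁ (cong₂ _+_ h-x₂ (sum-map-ys-≢ᵇ h j (y-≢ᵇ-y j) h-y))) ⟩
    s + (s + ℓ * s)
      ≡⟨ cong (λ t → t + (t + ℓ * t)) (sym ℓ+1≡s) ⟩
    suc ℓ + (suc ℓ + ℓ * suc ℓ)
      ≡⟨ arith ℓ ⟩
    suc ℓ * suc (suc ℓ)
      ≡⟨ cong (λ t → t * suc t) ℓ+1≡s ⟩
    s * suc s ∎
    where
    open ≡-Reasoning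
    q : Fin (5 + s) → Bool
    q w = nonIncident (a , y j) (b , w)
    W = filterᵇ q xys
    ℓ = length (filterᵇ (j ≢ᵇ_) (allFin s))
    ℓ+1≡s : suc ℓ ≡ s
    ℓ+1≡s = length-filterᵇ-≢ᵇ j
    h : Fin (5 + s) → ℕ
    h w = countMatchings (filterᵇ (nonIncident (b , w)) (star c W)) 1
    h≡ : ∀ w → h w ≡ length (filterᵇ (λ v → q v ∧ nonIncident (b , w) (c , v)) xys)
    h≡ w = trans (countMatchings-one (filterᵇ (nonIncident (b , w)) (star c W)))
      (trans (length-filterᵇ-map (nonIncident (b , w)) (c ,_) W)
        (cong length (filterᵇ-filterᵇ (λ v → nonIncident (b , w) (c , v)) q xys)))
    h-x₁ : h x₁ ≡ s
    h-x₁ = trans (h≡ x₁) (length-filterᵇ-ys-≢ᵇ j (λ k → trans (∧-identityʳ _) (y-≢ᵇ-y j k)))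
    h-x₂ : h x₂ ≡ s
    h-x₂ = trans (h≡ x₂) (length-filterᵇ-ys-≢ᵇ j (λ k → trans (∧-identityʳ _) (y-≢ᵇ-y j k)))
    h-y : ∀ k → j ≢ k → h (y k) ≡ s
    h-y k j≢k = trans (h≡ (y k)) (length-filterᵇ-ys-≢ᵇ₂ j≢k (λ l → cong₂ _∧_ (y-≢ᵇ-y j l) (y-≢ᵇ-y k l)))
    arith : ∀ ℓ → suc ℓ + (suc ℓ + ℓ * suc ℓ) ≡ suc ℓ * suc (suc ℓ)
    arith = solve-∀

  numMatchings-graph-3 : numMatchings graph 3 ≡ s * s * (s + 1)
  numMatchings-graph-3 = begin
    numMatchings graph 3
      ≡⟨ numMatchings-graph-edgeList 3 ⟩
    countMatchings (star a (b ∷ ys) ++ bcEdges) 3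
      ≡⟨ countMatchings-star-++ a (b ∷ ys) bcEdges 2 ⟩
    countMatchings bcEdges 3 + (countMatchings (filterᵇ (nonIncident (a , b)) bcEdges) 2 + sum (map avoiding-a ys))
      ≡⟨ cong₂ _+_ (countMatchings-unionOfStars bcEdges-stars 0)
           (cong₂ _+_ countMatchings-avoiding-ab-2 (sum-map-ys avoiding-a countMatchings-avoiding-ay-2)) ⟩
    s * (s * suc s)
      ≡⟨ arith s ⟩
    s * s * (s + 1) ∎
    where
    open ≡-Reasoning
    arith : ∀ s → s * (s * suc s) ≡ s * s * (s + 1)
    arith = solve-∀
    avoiding-a : Fin (5 + s) → ℕ
    avoiding-a v = countMatchings (filterᵇ (nonIncident (a , v)) bcEdges) 2

  numMatchings-graph-≥4 : ∀ r → numMatchings graph (4 + r) ≡ 0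
  numMatchings-graph-≥4 r = trans (numMatchings-graph-edgeList (4 + r))
    (countMatchings-unionOfStars (addStar a (b ∷ ys) bcEdges-stars) r)

  hub : Fin (5 + s) → Fin (5 + s)
  hub (fsuc fzero) = c
  hub _            = b

  module _ (v : Fin (5 + s)) (b≢v : b ≢ v)
           (x : Fin (5 + s)) (cx : adj graph c x ≡ true) (xb : adj graph x b ≡ true) (x≢v : x ≢ v) where

    to-b-avoiding : ∀ u → u ≢ v → ReachAvoiding graph v u b
    to-b-avoiding fzero                                 u≢v = step u≢v refl (here b≢v)
    to-b-avoiding (fsuc fzero)                          _   = here b≢v
    to-b-avoiding (fsuc (fsuc fzero))                   u≢v = step u≢v cx (step x≢v xb (here b≢v))
    to-b-avoiding (fsuc (fsuc (fsuc fzero)))            u≢v = step u≢v refl (here b≢v)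
    to-b-avoiding (fsuc (fsuc (fsuc (fsuc fzero))))     u≢v = step u≢v refl (here b≢v)
    to-b-avoiding (fsuc (fsuc (fsuc (fsuc (fsuc _))))) u≢v = step u≢v refl (here b≢v)

  module _ (j : Fin s) where

    to-c-avoiding-b : ∀ u → u ≢ b → ReachAvoiding graph b u c
    to-c-avoiding-b fzero                                 u≢b = step {w = y j} u≢b refl (step (λ ()) refl (here (λ ())))
    to-c-avoiding-b (fsuc fzero)                          u≢b = contradiction refl u≢b
    to-c-avoiding-b (fsuc (fsuc fzero))                   _   = here (λ ())
    to-c-avoiding-b (fsuc (fsuc (fsuc fzero)))            u≢b = step u≢b refl (here (λ ()))
    to-c-avoiding-b (fsuc (fsuc (fsuc (fsuc fzero))))     u≢b = step u≢b refl (here (λ ()))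
    to-c-avoiding-b (fsuc (fsuc (fsuc (fsuc (fsuc _))))) u≢b = step u≢b refl (here (λ ()))

    to-hub-avoiding : ∀ v u → u ≢ v → ReachAvoiding graph v u (hub v)
    to-hub-avoiding fzero                                 = to-b-avoiding a  (λ ()) x₁ refl refl (λ ())
    to-hub-avoiding (fsuc fzero)                          = to-c-avoiding-b
    to-hub-avoiding (fsuc (fsuc fzero))                   = to-b-avoiding c  (λ ()) x₁ refl refl (λ ())
    to-hub-avoiding (fsuc (fsuc (fsuc fzero)))            = to-b-avoiding x₁ (λ ()) x₂ refl refl (λ ())
    to-hub-avoiding (fsuc (fsuc (fsuc (fsuc fzero))))     = to-b-avoiding x₂ (λ ()) x₁ refl refl (λ ())
    to-hub-avoiding (fsuc (fsuc (fsuc (fsuc (fsuc i))))) = to-b-avoiding (y i) (λ ()) x₁ refl refl (λ ())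

  to-b : ∀ u → Reach graph u b
  to-b fzero    = step refl here
  to-b (fsuc u) = reachAvoiding⇒reach graph (to-b-avoiding a (λ ()) x₁ refl refl (λ ()) (fsuc u) (λ ()))

  -- The argument is a y-vertex: without one, deleting b isolates a.
  graph-twoConnected : Fin s → TwoConnected graph
  graph-twoConnected j =
    s≤s (s≤s (s≤s z≤n)) , connected-via-root graph to-b , avoiding-connected-via-hubs graph hub (to-hub-avoiding j)

yCount : ℕ → ℕ
yCount k = suc k * (3 + k)

module _ where

  open import Data.Integer as ℤ using (ℤ; +_; -_; _^_)
  open import Data.Integer.Properties using (pos-+; pos-*)
  import Data.Integer.Properties as ℤₚ
  import Data.Integer.Tactic.RingSolver as ℤ-Solver
  open import Data.Vec as Vec using (Vec; _∷_)

  foldr-+-applyUpTo-vanishing : ∀ (f : ℕ → ℤ) g q → (∀ r → f (g r) ≡ + 0) →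
    foldr ℤ._+_ (+ 0) (map f (applyUpTo g q)) ≡ + 0
  foldr-+-applyUpTo-vanishing f g zero    _      = refl
  foldr-+-applyUpTo-vanishing f g (suc q) f∘g≡0 =
    cong₂ ℤ._+_ (f∘g≡0 0) (foldr-+-applyUpTo-vanishing f (g ∘ suc) q (f∘g≡0 ∘ suc))

  foldr-+-upTo-vanishing-from-4 : ∀ (f : ℕ → ℤ) {m} → 3 ≤ m → (∀ r → f (4 + r) ≡ + 0) →
    foldr ℤ._+_ (+ 0) (map f (upTo (suc m))) ≡ f 0 ℤ.+ (f 1 ℤ.+ (f 2 ℤ.+ (f 3 ℤ.+ + 0)))
  foldr-+-upTo-vanishing-from-4 f {suc (suc (suc q))} (s≤s (s≤s (s≤s z≤n))) vanish =
    cong (λ z → f 0 ℤ.+ (f 1 ℤ.+ (f 2 ℤ.+ (f 3 ℤ.+ z)))) (foldr-+-applyUpTo-vanishing f (λ r → 4 + r) q vanish)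

  matchingPoly-of-no-4-matchings : ∀ {n} (G : Graph n) → 6 ≤ n → (∀ r → numMatchings G (4 + r) ≡ 0) → ∀ x →
    matchingPoly G x ≡ x ^ n ℤ.- + numMatchings G 1 ℤ.* x ^ (n ∸ 2) ℤ.+ + numMatchings G 2 ℤ.* x ^ (n ∸ 4)
                       ℤ.- + numMatchings G 3 ℤ.* x ^ (n ∸ 6)
  matchingPoly-of-no-4-matchings {n} G 6≤n no-4-matchings x = begin
    matchingPoly G x
      ≡⟨ foldr-+-upTo-vanishing-from-4 term (/-monoˡ-≤ 2 6≤n) term-vanishes ⟩
    term 0 ℤ.+ (term 1 ℤ.+ (term 2 ℤ.+ (term 3 ℤ.+ + 0)))
      ≡⟨ cong (λ m → + 1 ℤ.* + m ℤ.* x ^ n ℤ.+ (term 1 ℤ.+ (term 2 ℤ.+ (term 3 ℤ.+ + 0))))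
              (countMatchings-zero (edges G)) ⟩
    + 1 ℤ.* + 1 ℤ.* x ^ n ℤ.+ (term 1 ℤ.+ (term 2 ℤ.+ (term 3 ℤ.+ + 0)))
      ≡⟨ signs (+ numMatchings G 1) (+ numMatchings G 2) (+ numMatchings G 3)
               (x ^ n) (x ^ (n ∸ 2)) (x ^ (n ∸ 4)) (x ^ (n ∸ 6)) ⟩
    x ^ n ℤ.- + numMatchings G 1 ℤ.* x ^ (n ∸ 2) ℤ.+ + numMatchings G 2 ℤ.* x ^ (n ∸ 4)
    ℤ.- + numMatchings G 3 ℤ.* x ^ (n ∸ 6) ∎
    where
    open ≡-Reasoning
    term : ℕ → ℤ
    term r = ((- (+ 1)) ^ r) ℤ.* (+ numMatchings G r) ℤ.* (x ^ (n ∸ 2 * r))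
    term-vanishes : ∀ r → term (4 + r) ≡ + 0
    term-vanishes r = begin
      (- (+ 1)) ^ (4 + r) ℤ.* + numMatchings G (4 + r) ℤ.* x ^ (n ∸ 2 * (4 + r))
        ≡⟨ cong (λ m → (- (+ 1)) ^ (4 + r) ℤ.* + m ℤ.* x ^ (n ∸ 2 * (4 + r))) (no-4-matchings r) ⟩
      (- (+ 1)) ^ (4 + r) ℤ.* + 0 ℤ.* x ^ (n ∸ 2 * (4 + r))
        ≡⟨ cong (ℤ._* x ^ (n ∸ 2 * (4 + r))) (ℤₚ.*-zeroʳ ((- (+ 1)) ^ (4 + r))) ⟩
      + 0 ℤ.* x ^ (n ∸ 2 * (4 + r))
        ≡⟨ ℤₚ.*-zeroˡ (x ^ (n ∸ 2 * (4 + r))) ⟩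
      + 0 ∎
    -- (- 1) ^ r unfolded for r ≤ 3
    signs : ∀ m₁ m₂ m₃ X₀ X₁ X₂ X₃ →
      + 1 ℤ.* + 1 ℤ.* X₀ ℤ.+ ((- (+ 1) ℤ.* + 1) ℤ.* m₁ ℤ.* X₁ ℤ.+ ((- (+ 1) ℤ.* (- (+ 1) ℤ.* + 1)) ℤ.* m₂ ℤ.* X₂
        ℤ.+ ((- (+ 1) ℤ.* (- (+ 1) ℤ.* (- (+ 1) ℤ.* + 1))) ℤ.* m₃ ℤ.* X₃ ℤ.+ + 0)))
      ≡ X₀ ℤ.- m₁ ℤ.* X₁ ℤ.+ m₂ ℤ.* X₂ ℤ.- m₃ ℤ.* X₃
    signs = ℤ-Solver.solve-∀

  graphMatchingPoly : ℕ → ℤ → ℤ → ℤ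
  graphMatchingPoly t S x =
    x ^ (6 + t) ℤ.- (+ 3 ℤ.* S ℤ.+ + 5) ℤ.* x ^ (4 + t) ℤ.+ (+ 3 ℤ.* S ℤ.* S ℤ.+ + 6 ℤ.* S ℤ.+ + 4) ℤ.* x ^ (2 + t)
    ℤ.- S ℤ.* S ℤ.* (S ℤ.+ + 1) ℤ.* x ^ t

  graph-matchingPoly : ∀ t x → matchingPoly (Family.graph (suc t)) x ≡ graphMatchingPoly t (+ suc t) x
  graph-matchingPoly t x = begin
    matchingPoly G x
      ≡⟨ matchingPoly-of-no-4-matchings G (s≤s (s≤s (s≤s (s≤s (s≤s (s≤s z≤n)))))) (Family.numMatchings-graph-≥4 s) x ⟩
    F (+ m 1) (+ m 2) (+ m 3)
      ≡⟨ cong (λ M → F M (+ m 2) (+ m 3)) (trans (cong +_ (Family.numMatchings-graph-1 s)) cast₁) ⟩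
    F M₁ (+ m 2) (+ m 3)
      ≡⟨ cong (λ M → F M₁ M (+ m 3)) (trans (cong +_ (Family.numMatchings-graph-2 s)) cast₂) ⟩
    F M₁ M₂ (+ m 3)
      ≡⟨ cong (F M₁ M₂) (trans (cong +_ (Family.numMatchings-graph-3 s)) cast₃) ⟩
    F M₁ M₂ M₃ ∎
    where
    open ≡-Reasoning
    s = suc t
    S = + s
    G = Family.graph s
    m : ℕ → ℕ
    m = numMatchings G
    F : ℤ → ℤ → ℤ → ℤ
    F N₁ N₂ N₃ = x ^ (6 + t) ℤ.- N₁ ℤ.* x ^ (4 + t) ℤ.+ N₂ ℤ.* x ^ (2 + t) ℤ.- N₃ ℤ.* x ^ t
    M₁ M₂ M₃ : ℤ
    M₁ = + 3 ℤ.* S ℤ.+ + 5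
    M₂ = + 3 ℤ.* S ℤ.* S ℤ.+ + 6 ℤ.* S ℤ.+ + 4
    M₃ = S ℤ.* S ℤ.* (S ℤ.+ + 1)
    cast₁ : + (3 * s + 5) ≡ M₁
    cast₁ = trans (pos-+ (3 * s) 5) (cong (ℤ._+ + 5) (pos-* 3 s))
    cast₂ : + (3 * s * s + 6 * s + 4) ≡ M₂
    cast₂ = trans (pos-+ (3 * s * s + 6 * s) 4) (cong (ℤ._+ + 4) (trans (pos-+ (3 * s * s) (6 * s))
      (cong₂ ℤ._+_ (trans (pos-* (3 * s) s) (cong (ℤ._* S) (pos-* 3 s))) (pos-* 6 s))))
    cast₃ : + (s * s * (s + 1)) ≡ M₃
    cast₃ = trans (pos-* (s * s) (s + 1)) (cong₂ ℤ._*_ (pos-* s s) (pos-+ s 1))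

  graphMatchingPoly-factorisation : ∀ k t x → let K = + k in
    graphMatchingPoly t ((+ 1 ℤ.+ K) ℤ.* (+ 3 ℤ.+ K)) x ≡
      (x ℤ.- (K ℤ.+ + 1)) ℤ.* ((x ℤ.- - (K ℤ.+ + 1)) ℤ.* ((x ℤ.- (K ℤ.+ + 2)) ℤ.* ((x ℤ.- - (K ℤ.+ + 2)) ℤ.*
        ((x ℤ.- (K ℤ.+ + 3)) ℤ.* ((x ℤ.- - (K ℤ.+ + 3)) ℤ.* x ^ t)))))
  graphMatchingPoly-factorisation k t x = ring (+ k) x (x ^ t)
    where
    -- x ^ (6 + t) unfolds to the nested products below, with X = x ^ t; the solver does not handle _^_.
    ring : ∀ K x X → let S = (+ 1 ℤ.+ K) ℤ.* (+ 3 ℤ.+ K) in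
      x ℤ.* (x ℤ.* (x ℤ.* (x ℤ.* (x ℤ.* (x ℤ.* X))))) ℤ.- (+ 3 ℤ.* S ℤ.+ + 5) ℤ.* (x ℤ.* (x ℤ.* (x ℤ.* (x ℤ.* X))))
        ℤ.+ (+ 3 ℤ.* S ℤ.* S ℤ.+ + 6 ℤ.* S ℤ.+ + 4) ℤ.* (x ℤ.* (x ℤ.* X)) ℤ.- S ℤ.* S ℤ.* (S ℤ.+ + 1) ℤ.* X
      ≡ (x ℤ.- (K ℤ.+ + 1)) ℤ.* ((x ℤ.- - (K ℤ.+ + 1)) ℤ.* ((x ℤ.- (K ℤ.+ + 2)) ℤ.* ((x ℤ.- - (K ℤ.+ + 2)) ℤ.*
          ((x ℤ.- (K ℤ.+ + 3)) ℤ.* ((x ℤ.- - (K ℤ.+ + 3)) ℤ.* X)))))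
    ring = ℤ-Solver.solve-∀

  ∏-x-zeros : ∀ x m → Vec.foldr _ (λ aᵢ acc → (x ℤ.- aᵢ) ℤ.* acc) (+ 1) (Vec.replicate m (+ 0)) ≡ x ^ m
  ∏-x-zeros x zero    = refl
  ∏-x-zeros x (suc m) = cong₂ ℤ._*_ (ℤₚ.+-identityʳ x) (∏-x-zeros x m)

  graph-matchingIntegral : ∀ k → MatchingIntegral (Family.graph (yCount k))
  graph-matchingIntegral k = roots , λ x → begin
    matchingPoly (Family.graph (suc t)) x
      ≡⟨ graph-matchingPoly t x ⟩
    graphMatchingPoly t (+ suc t) x
      ≡⟨ cong (λ S → graphMatchingPoly t S x) cast-yCount ⟩
    graphMatchingPoly t ((+ 1 ℤ.+ K) ℤ.* (+ 3 ℤ.+ K)) x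
      ≡⟨ graphMatchingPoly-factorisation k t x ⟩
    ∏ x (x ^ t)
      ≡⟨ cong (∏ x) (sym (∏-x-zeros x t)) ⟩
    Vec.foldr _ (λ aᵢ acc → (x ℤ.- aᵢ) ℤ.* acc) (+ 1) roots ∎
    where
    open ≡-Reasoning
    -- chosen so that suc t and yCount k agree by definition
    t = 2 + (k + k * (3 + k))
    K = + k
    roots : Vec ℤ (5 + suc t)
    roots = K ℤ.+ + 1 ∷ - (K ℤ.+ + 1) ∷ K ℤ.+ + 2 ∷ - (K ℤ.+ + 2) ∷ K ℤ.+ + 3 ∷ - (K ℤ.+ + 3) ∷ Vec.replicate t (+ 0)
    ∏ : ℤ → ℤ → ℤ
    ∏ x X = (x ℤ.- (K ℤ.+ + 1)) ℤ.* ((x ℤ.- - (K ℤ.+ + 1)) ℤ.* ((x ℤ.- (K ℤ.+ + 2)) ℤ.* ((x ℤ.- - (K ℤ.+ + 2)) ℤ.*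
      ((x ℤ.- (K ℤ.+ + 3)) ℤ.* ((x ℤ.- - (K ℤ.+ + 3)) ℤ.* X)))))
    cast-yCount : + suc t ≡ (+ 1 ℤ.+ K) ℤ.* (+ 3 ℤ.+ K)
    cast-yCount = trans (pos-* (suc k) (3 + k)) (cong₂ ℤ._*_ (pos-+ 1 k) (pos-+ 3 k))

yCount-mono-< : ∀ {k l} → k < l → yCount k < yCount l
yCount-mono-< k<l = *-mono-< (s≤s k<l) (+-monoʳ-< 3 k<l)

yCount-injective : ∀ {k l} → yCount k ≡ yCount l → k ≡ l
yCount-injective {k} {l} eq with <-cmp k l
... | tri< k<l _ _ = contradiction eq (<⇒≢ (yCount-mono-< k<l))
... | tri≈ _ k≡l _ = k≡l
... | tri> _ _ l<k = contradiction (sym eq) (<⇒≢ (yCount-mono-< l<k))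

mainTheorem1 : Σ (ℕ → AnyGraph) λ F →
    (∀ k → TwoConnected (proj₂ (F k)) × MatchingIntegral (proj₂ (F k)))
    × (∀ k l → k ≢ l → ¬ Isomorphic (proj₂ (F k)) (proj₂ (F l)))
mainTheorem1 =
  (λ k → 5 + yCount k , Family.graph (yCount k)) ,
  (λ k → Family.graph-twoConnected (yCount k) fzero , graph-matchingIntegral k) ,
  (λ k l k≢l (f , _) → k≢l (yCount-injective (+-cancelˡ-≡ 5 _ _ (↔⇒≡ f))))
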